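{- Let $T$ be a complete first-order theory with monster model $\mathbb{M}$, and let $\varphi(\bar{x};\bar{y})$ be a partitioned formula which is stable and $d$-*maximum for some $d\in\omega$. Then there is $N\in\omega$ such that for all $c_1,c_2\in\mathcal{C}_{\varphi^*}(\mathbb{M})$, $|c_1\,\Delta\,c_2|<N$.
   Context: $c_1\Delta c_2$ denotes symmetric difference. $\varphi(\bar{x};\bar{y})$ is stable if for some $N\in\omega$ there are no $\bar{a}_1,\ldots,\bar{a}_N\in M^{|\bar{x}|}$ and $\bar{b}_1,\ldots,\bar{b}_N\in M^{|\bar{y}|}$ with $\models\varphi(\bar{a}_i;\bar{b}_j)\iff i<j$ for all $i,j$. Let $\mathcal{C}_{\varphi^*}(\mathbb{M})=\{\{\bar{b}\in M^{|\bar{y}|}:\models\varphi(\bar{a};\bar{b})\}:\bar{a}\in M^{|\bar{x}|}\}$. For $\mathcal{C}\subseteq 2^X$ and $A\subseteq X$, $\mathcal{C}(A)=\{c\cap A:c\in\mathcal{C}\}$; $\mathcal{C}$ shatters $A$ if $\mathcal{C}(A)=2^A$; VC dimension is the supremum of sizes of shattered sets; with $\Phi_d(n)=\sum_{i=0}^d\binom ni$, $\mathcal{C}$ is $d$-maximum if its VC dimension is $d$ and $|\mathcal{C}(A)|=\Phi_d(|A|)$ for every finite $A\subseteq X$. $\varphi$ is $d$-*maximum if $\mathcal{C}_{\varphi^*}(\mathbb{M})$ is $d$-maximum. -}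

module Defs where

open import Data.Nat using (ℕ; zero; suc; _+_; _<_)
open import Data.Nat.Combinatorics using (_C_)
open import Data.Bool using (Bool; true; false; T)
open import Data.Fin using (Fin)
import Data.Fin as Fin
open import Data.Vec using (Vec; tabulate; lookup)
open import Data.Product using (Σ; ∃; _×_; _,_)
open import Data.Sum using (_⊎_)
open import Relation.Nullary using (¬_)
open import Relation.Binary.PropositionalEquality using (_≡_; _≢_)
open import Function.Definitions using (Injective)
open import Function.Bundles using (_⇔_)

-- Setting: a structure with universe M; a partitioned formula φ(x̄;ȳ) with
-- |x̄| = lx and |ȳ| = ly is given by its truth value  φ ā b̄ : Bool.
Formula : Set → ℕ → ℕ → Set
Formula M lx ly = Vec M lx → Vec M ly → Bool

Φ : ℕ → ℕ → ℕ
Φ zero    n = n C 0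
Φ (suc d) n = Φ d n + n C (suc d)

module _ {M : Set} {lx ly : ℕ} (φ : Formula M lx ly) where

  Stable : Set
  Stable = ∃ λ N → (as : Fin N → Vec M lx) (bs : Fin N → Vec M ly) →
    ¬ (∀ i j → (T (φ (as i) (bs j)) ⇔ (i Fin.< j)))

  -- the concept of C_{φ*}(M) defined by the parameter ā :
  -- { b̄ ∈ M^{ly} : ⊨ φ(ā; b̄) }
  Concept : Vec M lx → Vec M ly → Set
  Concept a b = T (φ a b)

  -- a finite subset A ⊆ M^{ly} of size n is given by an injective
  -- enumeration f : Fin n → M^{ly}.  The trace c ∩ A of the concept of ā
  -- on A, as a subset of Fin n (bit vector).
  trace : {n : ℕ} → (Fin n → Vec M ly) → Vec M lx → Vec Bool n
  trace f a = tabulate (λ i → φ a (f i))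

  -- |C(A)| = k : there is a duplicate-free list of k subsets of A which
  -- are exactly the traces of the concepts on A.
  TraceCount : {n : ℕ} → (Fin n → Vec M ly) → ℕ → Set
  TraceCount {n} f k = Σ (Vec (Vec Bool n) k) λ L →
      Injective _≡_ _≡_ (lookup L)
    × (∀ i → ∃ λ a → trace f a ≡ lookup L i)
    × (∀ a → ∃ λ i → lookup L i ≡ trace f a)

  Shatters : {n : ℕ} → (Fin n → Vec M ly) → Set
  Shatters {n} f = (s : Vec Bool n) → ∃ λ a → trace f a ≡ s

  VCdim≡ : ℕ → Set
  VCdim≡ d =
      (∃ λ (f : Fin d → Vec M ly) → Injective _≡_ _≡_ f × Shatters f)
    × (∀ (f : Fin (suc d) → Vec M ly) → Injective _≡_ _≡_ f → ¬ Shatters f)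

  Maximum* : ℕ → Set
  Maximum* d = VCdim≡ d ×
    (∀ n (f : Fin n → Vec M ly) → Injective _≡_ _≡_ f → TraceCount f (Φ d n))

  InSymDiff : Vec M lx → Vec M lx → Vec M ly → Set
  InSymDiff a₁ a₂ b = (Concept a₁ b × ¬ Concept a₂ b) ⊎ (Concept a₂ b × ¬ Concept a₁ b)

  SymDiffSmallerThan : Vec M lx → Vec M lx → ℕ → Set
  SymDiffSmallerThan a₁ a₂ N = (g : Fin N → Vec M ly) → Injective _≡_ _≡_ g →
    ¬ (∀ i → InSymDiff a₁ a₂ (g i))

module Submission where

-- Let ā₁, ā₂ be parameters and take n = 2N distinct points of c₁ Δ c₂, N being the stability bound.  One
-- of c₁ ∖ c₂ and c₂ ∖ c₁ contains at least N of them; on that set B of points, one concept has trace ∅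
-- and the other trace B.  The family D of all traces on B has exactly Φ_d(|B|) members because φ is
-- d-maximum, and it only shatters sets of size ≤ d, of which there are Φ_d(|B|); by Pajor's inequality
-- (|D| ≤ number of sets shattered by D) D is therefore shattering-extremal.  In an extremal family any two
-- members u ⊆ v are joined by a monotone path inside the family that adds one point at a time.  From ∅
-- to B this gives traces t₀ ⊂ t₁ ⊂ … ⊂ t_|B| and points p₀, …, p_{|B|-1} with p_j ∈ t_i iff j < i: a
-- half-graph of length |B| ≥ N, contradicting stability.

open import Data.Bool as Bool using (Bool; true; false; _∧_; _∨_; not; T; if_then_else_)
open import Data.Bool.Properties using (T-≡; ∧-conicalˡ; ∧-conicalʳ; ∨-zeroʳ)
open import Data.Empty using (⊥-elim)
open import Data.Fin as Fin using (Fin; zero; suc; toℕ; punchIn; _↑ˡ_; _↑ʳ_; splitAt)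
open import Data.Fin.Properties
  using (toℕ<n; suc-injective; ↑ˡ-injective; ↑ʳ-injective; splitAt-↑ˡ; splitAt-↑ʳ; injective⇒≤)
open import Data.Nat using (ℕ; zero; suc; _+_; _∸_; _≤_; _<_; z≤n; s≤s; s<s⁻¹; _≤?_)
open import Data.Nat.Combinatorics using (_C_; nCk+nC[k+1]≡[n+1]C[k+1])
open import Data.Nat.Properties hiding (suc-injective)
open import Algebra.Properties.CommutativeSemigroup +-commutativeSemigroup using (interchange)
open import Data.Product using (Σ; ∃; _×_; _,_; proj₁; proj₂)
open import Data.Sum using (_⊎_; inj₁; inj₂; swap)
open import Data.Unit using (⊤; tt)
open import Data.Vec using (Vec; []; _∷_; lookup; tabulate; insertAt; removeAt; replicate)
open import Data.Vec.Membership.Propositional.Properties using (∈-lookup)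
open import Data.Vec.Properties
  using (≡-dec; ∷-injectiveˡ; ∷-injectiveʳ; insertAt-punchIn; insertAt-removeAt; lookup∘tabulate; lookup-replicate)
open import Data.Vec.Relation.Unary.Any using (any?; index)
open import Data.Vec.Relation.Unary.Any.Properties using (lookup-index)
open import Function.Base using (_∘_)
import Function.Properties.Equivalence as ⇔
open import Function.Bundles using (_⇔_; mk⇔)
open import Function.Definitions using (Injective)
open import Relation.Binary using (Tri; tri<; tri≈; tri>)
open import Relation.Binary.PropositionalEquality
open import Relation.Nullary using (¬_; Dec; yes; no; does)
open import Relation.Nullary.Decidable using (dec-true)

open import Defs

∨-trueˡ : ∀ {a} b → a ≡ true → a ∨ b ≡ true
∨-trueˡ b refl = refl

∨-trueʳ : ∀ a {b} → b ≡ true → a ∨ b ≡ true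
∨-trueʳ a refl = ∨-zeroʳ a

∨-true⁻ : ∀ a b → a ∨ b ≡ true → a ≡ true ⊎ b ≡ true
∨-true⁻ true  b _ = inj₁ refl
∨-true⁻ false b e = inj₂ e

∧-true : ∀ {a b} → a ≡ true → b ≡ true → a ∧ b ≡ true
∧-true refl refl = refl

∧-∨-∧-true : ∀ a b c d → (a ∧ b) ∨ (c ∧ d) ≡ true → a ∨ c ≡ true × b ∨ d ≡ true
∧-∨-∧-true a b c d e with ∨-true⁻ (a ∧ b) (c ∧ d) e
... | inj₁ ab = ∨-trueˡ c (∧-conicalˡ a b ab) , ∨-trueˡ d (∧-conicalʳ a b ab)
... | inj₂ cd = ∨-trueʳ a (∧-conicalˡ c d cd) , ∨-trueʳ b (∧-conicalʳ c d cd)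

∧-∧-∧-true : ∀ a b c d → (a ∧ b) ∧ (c ∧ d) ≡ true → a ∧ c ≡ true × b ∧ d ≡ true
∧-∧-∧-true true true true true _ = refl , refl

T-xor⇒≡not : ∀ {x y} → (T x × ¬ T y) ⊎ (T y × ¬ T x) → y ≡ not x
T-xor⇒≡not {true}  {false} _ = refl
T-xor⇒≡not {false} {true}  _ = refl
T-xor⇒≡not {true}  {true}  (inj₁ (_ , ¬y)) = ⊥-elim (¬y tt)
T-xor⇒≡not {true}  {true}  (inj₂ (_ , ¬x)) = ⊥-elim (¬x tt)
T-xor⇒≡not {false} {false} (inj₁ (() , _))
T-xor⇒≡not {false} {false} (inj₂ (() , _))

+-≤-squeeze : ∀ {a b c d} → a ≤ c → b ≤ d → c + d ≤ a + b → c ≤ a × d ≤ b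
+-≤-squeeze {a} {b} {c} {d} a≤c b≤d c+d≤a+b =
  +-cancelʳ-≤ b c a (≤-trans (+-monoʳ-≤ c b≤d) c+d≤a+b) ,
  +-cancelˡ-≤ a d b (≤-trans (+-monoˡ-≤ d a≤c) c+d≤a+b)

-- Families of subsets of Fin n, a subset being given by its characteristic bit vector.
Family : ℕ → Set
Family n = Vec Bool n → Bool

infix 4 _∈_ _⊆_
infixr 6 _∩_
infixr 5 _∪_

_∈_ : ∀ {n} → Vec Bool n → Family n → Set
v ∈ E = E v ≡ true

_⊆_ : ∀ {n} → Family n → Family n → Set
E ⊆ F = ∀ v → v ∈ E → v ∈ F

_∪_ _∩_ : ∀ {n} → Family n → Family n → Family n
(E ∪ F) v = E v ∨ F v
(E ∩ F) v = E v ∧ F v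

slice : ∀ {n} → Bool → Family (suc n) → Family n
slice b E v = E (b ∷ v)

sliceAt : ∀ {n} → Fin (suc n) → Bool → Family (suc n) → Family n
sliceAt i b E v = E (insertAt v i b)

card : ∀ {n} → Family n → ℕ
card {zero}  E = if E [] then 1 else 0
card {suc n} E = card (slice false E) + card (slice true E)

card-mono : ∀ {n} (E F : Family n) → E ⊆ F → card E ≤ card F
card-mono {zero} E F E⊆F with E [] in e
... | false = z≤n
... | true rewrite E⊆F [] e = ≤-refl
card-mono {suc n} E F E⊆F =
  +-mono-≤ (card-mono (slice false E) (slice false F) (λ v → E⊆F (false ∷ v)))
           (card-mono (slice true E) (slice true F) (λ v → E⊆F (true ∷ v)))

card-∪-∩ : ∀ {n} (E F : Family n) → card E + card F ≡ card (E ∪ F) + card (E ∩ F)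
card-∪-∩ {zero} E F with E [] | F []
... | true  | true  = refl
... | true  | false = refl
... | false | true  = refl
... | false | false = refl
card-∪-∩ {suc n} E F = begin
  (card E₀ + card E₁) + (card F₀ + card F₁)
    ≡⟨ interchange (card E₀) (card E₁) (card F₀) (card F₁) ⟩
  (card E₀ + card F₀) + (card E₁ + card F₁)
    ≡⟨ cong₂ _+_ (card-∪-∩ E₀ F₀) (card-∪-∩ E₁ F₁) ⟩
  (card (E₀ ∪ F₀) + card (E₀ ∩ F₀)) + (card (E₁ ∪ F₁) + card (E₁ ∩ F₁))
    ≡⟨ interchange (card (E₀ ∪ F₀)) (card (E₀ ∩ F₀)) (card (E₁ ∪ F₁)) (card (E₁ ∩ F₁)) ⟩
  (card (E₀ ∪ F₀) + card (E₁ ∪ F₁)) + (card (E₀ ∩ F₀) + card (E₁ ∩ F₁)) ∎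
  where
  open ≡-Reasoning
  E₀ = slice false E
  E₁ = slice true E
  F₀ = slice false F
  F₁ = slice true F

card-sliceAt : ∀ {n} (i : Fin (suc n)) (E : Family (suc n)) →
  card E ≡ card (sliceAt i false E) + card (sliceAt i true E)
card-sliceAt zero E = refl
card-sliceAt {suc n} (suc i) E = begin
  card E₀ + card E₁
    ≡⟨ cong₂ _+_ (card-sliceAt i E₀) (card-sliceAt i E₁) ⟩
  (card (sliceAt i false E₀) + card (sliceAt i true E₀)) +
  (card (sliceAt i false E₁) + card (sliceAt i true E₁))
    ≡⟨ interchange (card (sliceAt i false E₀)) _ _ _ ⟩
  (card (sliceAt i false E₀) + card (sliceAt i false E₁)) +
  (card (sliceAt i true E₀) + card (sliceAt i true E₁)) ∎
  where
  open ≡-Reasoning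
  E₀ = slice false E
  E₁ = slice true E

⊆⇒card-≥⇒⊇ : ∀ {n} (E F : Family n) → E ⊆ F → card F ≤ card E → F ⊆ E
⊆⇒card-≥⇒⊇ {zero} E F E⊆F F≤E [] v∈F with E [] in e
... | true  = refl
... | false rewrite v∈F = ⊥-elim (<⇒≱ ≤-refl F≤E)
⊆⇒card-≥⇒⊇ {suc n} E F E⊆F F≤E (b ∷ v) =
  ⊆⇒card-≥⇒⊇ (slice b E) (slice b F) (slice-⊆ b) (slice-≥ b) v
  where
  slice-⊆ : ∀ b → slice b E ⊆ slice b F
  slice-⊆ b w = E⊆F (b ∷ w)
  both-≥ = +-≤-squeeze (card-mono _ _ (slice-⊆ false)) (card-mono _ _ (slice-⊆ true)) F≤E
  slice-≥ : ∀ b → card (slice b F) ≤ card (slice b E)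
  slice-≥ false = proj₁ both-≥
  slice-≥ true  = proj₂ both-≥

-- S ∈ Shattered E iff E shatters the set with characteristic vector S.
Shattered : ∀ {n} → Family n → Family n
Shattered {zero}  E []          = E []
Shattered {suc n} E (false ∷ S) = Shattered (slice false E ∪ slice true E) S
Shattered {suc n} E (true ∷ S)  = Shattered (slice false E) S ∧ Shattered (slice true E) S

Shattered-mono : ∀ {n} (E F : Family n) → E ⊆ F → Shattered E ⊆ Shattered F
Shattered-mono {zero} E F E⊆F [] = E⊆F []
Shattered-mono {suc n} E F E⊆F (false ∷ S) = Shattered-mono _ _ ∪-mono S
  where
  ∪-mono : slice false E ∪ slice true E ⊆ slice false F ∪ slice true F
  ∪-mono v e with ∨-true⁻ (E (false ∷ v)) (E (true ∷ v)) e
  ... | inj₁ e₀ = ∨-trueˡ _ (E⊆F _ e₀)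
  ... | inj₂ e₁ = ∨-trueʳ _ (E⊆F _ e₁)
Shattered-mono {suc n} E F E⊆F (true ∷ S) e =
  ∧-true (Shattered-mono _ _ (λ v → E⊆F (false ∷ v)) S (∧-conicalˡ _ _ e))
         (Shattered-mono _ _ (λ v → E⊆F (true ∷ v)) S (∧-conicalʳ _ _ e))

Shattered-∪ : ∀ {n} (E F : Family n) → Shattered E ∪ Shattered F ⊆ Shattered (E ∪ F)
Shattered-∪ E F S e with ∨-true⁻ _ _ e
... | inj₁ S∈E = Shattered-mono E _ (λ v → ∨-trueˡ _) S S∈E
... | inj₂ S∈F = Shattered-mono F _ (λ v → ∨-trueʳ _) S S∈F

Shattered-∩ : ∀ {n} (E F : Family n) → Shattered (E ∩ F) ⊆ Shattered E ∩ Shattered F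
Shattered-∩ E F S e =
  ∧-true (Shattered-mono _ E (λ v → ∧-conicalˡ _ _) S e) (Shattered-mono _ F (λ v → ∧-conicalʳ _ _) S e)

card≤card-Shattered : ∀ {n} (E : Family n) → card E ≤ card (Shattered E)
card≤card-Shattered {zero} E = ≤-refl
card≤card-Shattered {suc n} E = begin
  card E₀ + card E₁
    ≤⟨ +-mono-≤ (card≤card-Shattered E₀) (card≤card-Shattered E₁) ⟩
  card (Shattered E₀) + card (Shattered E₁)
    ≡⟨ card-∪-∩ (Shattered E₀) (Shattered E₁) ⟩
  card (Shattered E₀ ∪ Shattered E₁) + card (Shattered E₀ ∩ Shattered E₁)
    ≤⟨ +-monoˡ-≤ _ (card-mono _ _ (Shattered-∪ E₀ E₁)) ⟩
  card (Shattered (E₀ ∪ E₁)) + card (Shattered E₀ ∩ Shattered E₁) ∎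
  where
  open ≤-Reasoning
  E₀ = slice false E
  E₁ = slice true E

Shattered-sliceAt-∪ : ∀ {n} (i : Fin (suc n)) (E : Family (suc n)) →
  Shattered (sliceAt i false E) ∪ Shattered (sliceAt i true E) ⊆ sliceAt i false (Shattered E)
Shattered-sliceAt-∪ zero E = Shattered-∪ (slice false E) (slice true E)
Shattered-sliceAt-∪ {suc n} (suc i) E (false ∷ S) = Shattered-sliceAt-∪ i (slice false E ∪ slice true E) S
Shattered-sliceAt-∪ {suc n} (suc i) E (true ∷ S) e =
  ∧-true (Shattered-sliceAt-∪ i (slice false E) S (proj₁ split))
         (Shattered-sliceAt-∪ i (slice true E) S (proj₂ split))
  where
  split = ∧-∨-∧-true (Shattered (sliceAt i false (slice false E)) S) (Shattered (sliceAt i false (slice true E)) S)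
                     (Shattered (sliceAt i true (slice false E)) S) (Shattered (sliceAt i true (slice true E)) S) e

Shattered-sliceAt-∩ : ∀ {n} (i : Fin (suc n)) (E : Family (suc n)) →
  Shattered (sliceAt i false E) ∩ Shattered (sliceAt i true E) ⊆ sliceAt i true (Shattered E)
Shattered-sliceAt-∩ zero E S e = e
Shattered-sliceAt-∩ {suc n} (suc i) E (false ∷ S) = Shattered-sliceAt-∩ i (slice false E ∪ slice true E) S
Shattered-sliceAt-∩ {suc n} (suc i) E (true ∷ S) e =
  ∧-true (Shattered-sliceAt-∩ i (slice false E) S (proj₁ split))
         (Shattered-sliceAt-∩ i (slice true E) S (proj₂ split))
  where
  split = ∧-∧-∧-true (Shattered (sliceAt i false (slice false E)) S) (Shattered (sliceAt i false (slice true E)) S)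
                     (Shattered (sliceAt i true (slice false E)) S) (Shattered (sliceAt i true (slice true E)) S) e

∅ : ∀ {n} → Vec Bool n
∅ = replicate _ false

full : ∀ {n} → Vec Bool n
full = replicate _ true

∈⇒∅∈Shattered : ∀ {n} (E : Family n) v → v ∈ E → ∅ ∈ Shattered E
∈⇒∅∈Shattered {zero} E [] e = e
∈⇒∅∈Shattered {suc n} E (b ∷ v) e = ∈⇒∅∈Shattered (slice false E ∪ slice true E) v (slice-∈ b e)
  where
  slice-∈ : ∀ b → E (b ∷ v) ≡ true → v ∈ slice false E ∪ slice true E
  slice-∈ false = ∨-trueˡ _
  slice-∈ true  = ∨-trueʳ _

∅∈Shattered⇒nonempty : ∀ {n} (E : Family n) → ∅ ∈ Shattered E → ∃ λ v → v ∈ E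
∅∈Shattered⇒nonempty {zero} E e = [] , e
∅∈Shattered⇒nonempty {suc n} E e with ∅∈Shattered⇒nonempty (slice false E ∪ slice true E) e
... | v , e′ with ∨-true⁻ _ _ e′
...   | inj₁ e₀ = false ∷ v , e₀
...   | inj₂ e₁ = true ∷ v , e₁

-- Shattering-extremal families: Pajor's inequality is an equality.
Extremal : ∀ {n} → Family n → Set
Extremal E = card (Shattered E) ≤ card E

slices-squeeze : ∀ {n} (i : Fin (suc n)) (E : Family (suc n)) → Extremal E →
  card (Shattered (sliceAt i false E)) + card (Shattered (sliceAt i true E)) ≤
  card (sliceAt i false E) + card (sliceAt i true E)
slices-squeeze i E ext = begin
  card (Shattered E₀) + card (Shattered E₁)
    ≡⟨ card-∪-∩ (Shattered E₀) (Shattered E₁) ⟩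
  card (Shattered E₀ ∪ Shattered E₁) + card (Shattered E₀ ∩ Shattered E₁)
    ≤⟨ +-mono-≤ (card-mono _ _ (Shattered-sliceAt-∪ i E)) (card-mono _ _ (Shattered-sliceAt-∩ i E)) ⟩
  card (sliceAt i false (Shattered E)) + card (sliceAt i true (Shattered E))
    ≡⟨ card-sliceAt i (Shattered E) ⟨
  card (Shattered E)
    ≤⟨ ext ⟩
  card E
    ≡⟨ card-sliceAt i E ⟩
  card E₀ + card E₁ ∎
  where
  open ≤-Reasoning
  E₀ = sliceAt i false E
  E₁ = sliceAt i true E

Extremal-sliceAt : ∀ {n} (i : Fin (suc n)) (E : Family (suc n)) → Extremal E →
  ∀ b → Extremal (sliceAt i b E)
Extremal-sliceAt i E ext b = pick b
  where
  both = +-≤-squeeze (card≤card-Shattered (sliceAt i false E)) (card≤card-Shattered (sliceAt i true E))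
                     (slices-squeeze i E ext)
  pick : ∀ b → Extremal (sliceAt i b E)
  pick false = proj₁ both
  pick true  = proj₂ both

-- Extremality forces Shattered (E₀ ∩ E₁) = Shattered E₀ ∩ Shattered E₁, and ∅ lies in the right-hand side.
Extremal-slices-meet : ∀ {n} (E : Family (suc n)) → Extremal E → ∀ v w →
  v ∈ slice false E → w ∈ slice true E → ∃ λ z → z ∈ slice false E ∩ slice true E
Extremal-slices-meet E ext v w v∈E₀ w∈E₁ =
  ∅∈Shattered⇒nonempty (E₀ ∩ E₁)
    (∩-Shattered ∅ (∧-true (∈⇒∅∈Shattered E₀ v v∈E₀) (∈⇒∅∈Shattered E₁ w w∈E₁)))
  where
  open ≤-Reasoning
  E₀ = slice false E
  E₁ = slice true E
  sum-bound : card (Shattered (E₀ ∪ E₁)) + card (Shattered E₀ ∩ Shattered E₁) ≤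
              card (E₀ ∪ E₁) + card (E₀ ∩ E₁)
  sum-bound = begin
    card (Shattered E) ≤⟨ ext ⟩
    card E             ≡⟨ card-∪-∩ E₀ E₁ ⟩
    card (E₀ ∪ E₁) + card (E₀ ∩ E₁) ∎
  ∩-bound : card (Shattered E₀ ∩ Shattered E₁) ≤ card (Shattered (E₀ ∩ E₁))
  ∩-bound = begin
    card (Shattered E₀ ∩ Shattered E₁)
      ≤⟨ +-cancelˡ-≤ (card (E₀ ∪ E₁)) _ _
           (≤-trans (+-monoˡ-≤ _ (card≤card-Shattered (E₀ ∪ E₁))) sum-bound) ⟩
    card (E₀ ∩ E₁)
      ≤⟨ card≤card-Shattered (E₀ ∩ E₁) ⟩
    card (Shattered (E₀ ∩ E₁)) ∎
  ∩-Shattered : Shattered E₀ ∩ Shattered E₁ ⊆ Shattered (E₀ ∩ E₁)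
  ∩-Shattered = ⊆⇒card-≥⇒⊇ _ _ (Shattered-∩ E₀ E₁) ∩-bound

infix 4 _⊑_

_⊑_ : ∀ {n} → Vec Bool n → Vec Bool n → Set
u ⊑ v = ∀ p → lookup u p ≡ true → lookup v p ≡ true

⊑-trans : ∀ {n} (u v w : Vec Bool n) → u ⊑ v → v ⊑ w → u ⊑ w
⊑-trans _ _ _ u⊑v v⊑w p e = v⊑w p (u⊑v p e)

⊑-false : ∀ {n} (u v : Vec Bool n) → u ⊑ v → ∀ p → lookup v p ≡ false → lookup u p ≡ false
⊑-false u v u⊑v p v[p] with lookup u p in u[p]
... | false = refl
... | true with () ← trans (sym v[p]) (u⊑v p u[p])

∷-⊑ : ∀ {n a b} {u v : Vec Bool n} → (a ≡ true → b ≡ true) → u ⊑ v → a ∷ u ⊑ b ∷ v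
∷-⊑ a⇒b u⊑v zero    = a⇒b
∷-⊑ a⇒b u⊑v (suc p) = u⊑v p

∷-⊑⁻ : ∀ {n a b} {u v : Vec Bool n} → a ∷ u ⊑ b ∷ v → u ⊑ v
∷-⊑⁻ u⊑v p = u⊑v (suc p)

insertAt-⊑ : ∀ {n} {u v : Vec Bool n} i b → u ⊑ v → insertAt u i b ⊑ insertAt v i b
insertAt-⊑ zero b u⊑v zero    e = e
insertAt-⊑ zero b u⊑v (suc p) e = u⊑v p e
insertAt-⊑ {u = _ ∷ _} {_ ∷ _} (suc i) b u⊑v zero    e = u⊑v zero e
insertAt-⊑ {u = _ ∷ _} {_ ∷ _} (suc i) b u⊑v (suc p) e = insertAt-⊑ i b (∷-⊑⁻ u⊑v) p e

insertAt-⊑⁻ : ∀ {n} (u v : Vec Bool n) i b → insertAt u i b ⊑ insertAt v i b → u ⊑ v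
insertAt-⊑⁻ u v i b u⊑v p e =
  trans (sym (insertAt-punchIn v i b p)) (u⊑v (punchIn i p) (trans (insertAt-punchIn u i b p) e))

ascent : Bool → Bool → ℕ
ascent false true = 1
ascent _     _    = 0

-- For u ⊑ v this is the Hamming distance.
ascents : ∀ {n} → Vec Bool n → Vec Bool n → ℕ
ascents []      []      = 0
ascents (a ∷ u) (b ∷ v) = ascent a b + ascents u v

ascents-insertAt : ∀ {n} (u v : Vec Bool n) i b → ascents (insertAt u i b) (insertAt v i b) ≡ ascents u v
ascents-insertAt u v zero false = refl
ascents-insertAt u v zero true  = refl
ascents-insertAt (a ∷ u) (c ∷ v) (suc i) b = cong (ascent a c +_) (ascents-insertAt u v i b)

ascent-trans : ∀ a b c → (a ≡ true → b ≡ true) → (b ≡ true → c ≡ true) →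
  ascent a b + ascent b c ≡ ascent a c
ascent-trans false false false _ _ = refl
ascent-trans false false true  _ _ = refl
ascent-trans false true  true  _ _ = refl
ascent-trans true  true  true  _ _ = refl
ascent-trans false true  false _   b⇒c with () ← b⇒c refl
ascent-trans true  false _     a⇒b _   with () ← a⇒b refl
ascent-trans true  true  false _   b⇒c with () ← b⇒c refl

ascents-trans : ∀ {n} (u v w : Vec Bool n) → u ⊑ v → v ⊑ w → ascents u v + ascents v w ≡ ascents u w
ascents-trans [] [] [] _ _ = refl
ascents-trans (a ∷ u) (b ∷ v) (c ∷ w) u⊑v v⊑w = begin
  (ascent a b + ascents u v) + (ascent b c + ascents v w)
    ≡⟨ interchange (ascent a b) (ascents u v) (ascent b c) (ascents v w) ⟩
  (ascent a b + ascent b c) + (ascents u v + ascents v w)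
    ≡⟨ cong₂ _+_ (ascent-trans a b c (u⊑v zero) (v⊑w zero))
                 (ascents-trans u v w (∷-⊑⁻ u⊑v) (∷-⊑⁻ v⊑w)) ⟩
  ascent a c + ascents u w ∎
  where open ≡-Reasoning

ascents-∅-full : ∀ n → ascents {n} ∅ full ≡ n
ascents-∅-full zero    = refl
ascents-∅-full (suc n) = cong suc (ascents-∅-full n)

-- A monotone geodesic u = point 0 ⊑ point 1 ⊑ … ⊑ point length = v inside E:
-- point i is obtained from u by switching on the coordinates flip 0, …, flip (i - 1).
record MonotonePath {n} (E : Family n) (u v : Vec Bool n) : Set where
  field
    length   : ℕ
    length≡  : length ≡ ascents u v
    point    : ℕ → Vec Bool n
    point∈   : ∀ i → i ≤ length → point i ∈ E
    above    : ∀ i → i ≤ length → u ⊑ point i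
    below    : ∀ i → i ≤ length → point i ⊑ v
    flip     : ∀ j → j < length → Fin n
    flip-off : ∀ j (j<l : j < length) → lookup u (flip j j<l) ≡ false
    flip-on  : ∀ j (j<l : j < length) → lookup v (flip j j<l) ≡ true
    flipped⇒ : ∀ i j (j<l : j < length) → i ≤ length → lookup (point i) (flip j j<l) ≡ true → j < i
    flipped⇐ : ∀ i j (j<l : j < length) → i ≤ length → j < i → lookup (point i) (flip j j<l) ≡ true

MonotonePath-insertAt : ∀ {n} (E : Family (suc n)) (i : Fin (suc n)) (b : Bool) {u v : Vec Bool n} →
  MonotonePath (sliceAt i b E) u v → MonotonePath E (insertAt u i b) (insertAt v i b)
MonotonePath-insertAt E i b {u} {v} P = record
  { length   = length
  ; length≡  = trans length≡ (sym (ascents-insertAt u v i b))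
  ; point    = λ k → insertAt (point k) i b
  ; point∈   = point∈
  ; above    = λ k k≤l → insertAt-⊑ i b (above k k≤l)
  ; below    = λ k k≤l → insertAt-⊑ i b (below k k≤l)
  ; flip     = λ j j<l → punchIn i (flip j j<l)
  ; flip-off = λ j j<l → trans (insertAt-punchIn u i b (flip j j<l)) (flip-off j j<l)
  ; flip-on  = λ j j<l → trans (insertAt-punchIn v i b (flip j j<l)) (flip-on j j<l)
  ; flipped⇒ = λ k j j<l k≤l e → flipped⇒ k j j<l k≤l (trans (sym (insertAt-punchIn (point k) i b (flip j j<l))) e)
  ; flipped⇐ = λ k j j<l k≤l j<k → trans (insertAt-punchIn (point k) i b (flip j j<l)) (flipped⇐ k j j<l k≤l j<k)
  }
  where open MonotonePath P

-- A path in the 0-slice from u to z, then the switch of coordinate 0, then a path in the 1-slice from z to v.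
module Join {n} (E : Family (suc n)) {u z v : Vec Bool n} (u⊑z : u ⊑ z) (z⊑v : z ⊑ v)
  (P₀ : MonotonePath (slice false E) u z) (P₁ : MonotonePath (slice true E) z v) where

  module P₀ = MonotonePath P₀
  module P₁ = MonotonePath P₁

  l₀ = P₀.length
  l₁ = P₁.length
  l = l₀ + suc l₁

  l∸[1+l₀]≡l₁ : l ∸ suc l₀ ≡ l₁
  l∸[1+l₀]≡l₁ = trans (cong (_∸ suc l₀) (+-suc l₀ l₁)) (m+n∸m≡n (suc l₀) l₁)

  shift-≤ : ∀ {i} → i ≤ l → i ∸ suc l₀ ≤ l₁
  shift-≤ i≤l = subst (_ ≤_) l∸[1+l₀]≡l₁ (∸-monoˡ-≤ (suc l₀) i≤l)

  shift-< : ∀ {j} → j < l → l₀ < j → j ∸ suc l₀ < l₁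
  shift-< j<l l₀<j = subst (_ <_) l∸[1+l₀]≡l₁ (∸-monoˡ-< j<l l₀<j)

  shift-reflects-< : ∀ {i j} → j ∸ suc l₀ < i ∸ suc l₀ → j < i
  shift-reflects-< lt = ≰⇒> (λ i≤j → <⇒≱ lt (∸-monoˡ-≤ (suc l₀) i≤j))

  pointBy : ∀ i → Dec (i ≤ l₀) → Vec Bool (suc n)
  pointBy i (yes _) = false ∷ P₀.point i
  pointBy i (no _)  = true ∷ P₁.point (i ∸ suc l₀)

  flipBy : ∀ j → j < l → Tri (j < l₀) (j ≡ l₀) (l₀ < j) → Fin (suc n)
  flipBy j j<l (tri< j<l₀ _ _) = suc (P₀.flip j j<l₀)
  flipBy j j<l (tri≈ _ _ _)    = zero
  flipBy j j<l (tri> _ _ l₀<j) = suc (P₁.flip (j ∸ suc l₀) (shift-< j<l l₀<j))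

  point∈ : ∀ i d → i ≤ l → pointBy i d ∈ E
  point∈ i (yes i≤l₀) _   = P₀.point∈ i i≤l₀
  point∈ i (no _)     i≤l = P₁.point∈ _ (shift-≤ i≤l)

  above : ∀ i d → i ≤ l → false ∷ u ⊑ pointBy i d
  above i (yes i≤l₀) _   = ∷-⊑ (λ ()) (P₀.above i i≤l₀)
  above i (no _)     i≤l =
    ∷-⊑ (λ _ → refl) (⊑-trans u z (P₁.point (i ∸ suc l₀)) u⊑z (P₁.above _ (shift-≤ i≤l)))

  below : ∀ i d → i ≤ l → pointBy i d ⊑ true ∷ v
  below i (yes i≤l₀) _   = ∷-⊑ (λ _ → refl) (⊑-trans (P₀.point i) z v (P₀.below i i≤l₀) z⊑v)
  below i (no _)     i≤l = ∷-⊑ (λ _ → refl) (P₁.below _ (shift-≤ i≤l))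

  flip-off : ∀ j j<l t → lookup (false ∷ u) (flipBy j j<l t) ≡ false
  flip-off j j<l (tri< j<l₀ _ _) = P₀.flip-off j j<l₀
  flip-off j j<l (tri≈ _ _ _)    = refl
  flip-off j j<l (tri> _ _ l₀<j) = ⊑-false u z u⊑z _ (P₁.flip-off _ (shift-< j<l l₀<j))

  flip-on : ∀ j j<l t → lookup (true ∷ v) (flipBy j j<l t) ≡ true
  flip-on j j<l (tri< j<l₀ _ _) = z⊑v _ (P₀.flip-on j j<l₀)
  flip-on j j<l (tri≈ _ _ _)    = refl
  flip-on j j<l (tri> _ _ l₀<j) = P₁.flip-on _ (shift-< j<l l₀<j)

  flipped⇒ : ∀ i j (j<l : j < l) d t → i ≤ l → lookup (pointBy i d) (flipBy j j<l t) ≡ true → j < i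
  flipped⇒ i j j<l (yes i≤l₀) (tri< j<l₀ _ _) _ e = P₀.flipped⇒ i j j<l₀ i≤l₀ e
  flipped⇒ i j j<l (yes i≤l₀) (tri> _ _ l₀<j) _ e
    with () ← trans (sym e) (⊑-false (P₀.point i) z (P₀.below i i≤l₀) _ (P₁.flip-off _ (shift-< j<l l₀<j)))
  flipped⇒ i j j<l (no i≰l₀) (tri< j<l₀ _ _) _ _   = <-trans j<l₀ (≰⇒> i≰l₀)
  flipped⇒ i j j<l (no i≰l₀) (tri≈ _ j≡l₀ _) _ _   = subst (_< i) (sym j≡l₀) (≰⇒> i≰l₀)
  flipped⇒ i j j<l (no i≰l₀) (tri> _ _ l₀<j) i≤l e =
    shift-reflects-< (P₁.flipped⇒ _ _ (shift-< j<l l₀<j) (shift-≤ i≤l) e)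

  flipped⇐ : ∀ i j (j<l : j < l) d t → i ≤ l → j < i → lookup (pointBy i d) (flipBy j j<l t) ≡ true
  flipped⇐ i j j<l (yes i≤l₀) (tri< j<l₀ _ _) _ j<i = P₀.flipped⇐ i j j<l₀ i≤l₀ j<i
  flipped⇐ i j j<l (yes i≤l₀) (tri≈ _ j≡l₀ _) _ j<i = ⊥-elim (<⇒≱ (subst (_< i) j≡l₀ j<i) i≤l₀)
  flipped⇐ i j j<l (yes i≤l₀) (tri> _ _ l₀<j) _ j<i = ⊥-elim (<⇒≱ (<-trans l₀<j j<i) i≤l₀)
  flipped⇐ i j j<l (no _)     (tri< j<l₀ _ _) i≤l _ = P₁.above _ (shift-≤ i≤l) _ (P₀.flip-on j j<l₀)
  flipped⇐ i j j<l (no _)     (tri≈ _ _ _)    _   _ = refl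
  flipped⇐ i j j<l (no _)     (tri> _ _ l₀<j) i≤l j<i =
    P₁.flipped⇐ _ _ (shift-< j<l l₀<j) (shift-≤ i≤l) (∸-monoˡ-< j<i l₀<j)

  path : MonotonePath E (false ∷ u) (true ∷ v)
  path = record
    { length   = l
    ; length≡  = trans (+-suc l₀ l₁)
                   (cong suc (trans (cong₂ _+_ P₀.length≡ P₁.length≡) (ascents-trans u z v u⊑z z⊑v)))
    ; point    = λ i → pointBy i (i ≤? l₀)
    ; point∈   = λ i → point∈ i (i ≤? l₀)
    ; above    = λ i → above i (i ≤? l₀)
    ; below    = λ i → below i (i ≤? l₀)
    ; flip     = λ j j<l → flipBy j j<l (<-cmp j l₀)
    ; flip-off = λ j j<l → flip-off j j<l (<-cmp j l₀)
    ; flip-on  = λ j j<l → flip-on j j<l (<-cmp j l₀)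
    ; flipped⇒ = λ i j j<l → flipped⇒ i j j<l (i ≤? l₀) (<-cmp j l₀)
    ; flipped⇐ = λ i j j<l → flipped⇐ i j j<l (i ≤? l₀) (<-cmp j l₀)
    }

≢-ascent : ∀ a b → (a ≡ true → b ≡ true) → a ≢ b → a ≡ false × b ≡ true
≢-ascent false true  _   _   = refl , refl
≢-ascent false false _   a≢b = ⊥-elim (a≢b refl)
≢-ascent true  true  _   a≢b = ⊥-elim (a≢b refl)
≢-ascent true  false a⇒b _   with () ← a⇒b refl

agree-or-opposite : ∀ {n} (u v : Vec Bool n) → u ⊑ v →
  (∃ λ j → lookup u j ≡ lookup v j) ⊎ (∀ j → lookup u j ≡ false × lookup v j ≡ true)
agree-or-opposite [] [] _ = inj₂ (λ ())
agree-or-opposite (a ∷ u) (b ∷ v) u⊑v with a Bool.≟ b | agree-or-opposite u v (∷-⊑⁻ u⊑v)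
... | yes a≡b | _             = inj₁ (zero , a≡b)
... | no _    | inj₁ (j , eq) = inj₁ (suc j , eq)
... | no a≢b  | inj₂ opposite = inj₂ λ { zero → ≢-ascent a b (u⊑v zero) a≢b ; (suc j) → opposite j }

-- Extremal families have isometric one-inclusion graphs (Bandelt, Chepoi, Dress and Koolen).  If u and v
-- agree at some coordinate, recurse into that section; otherwise u = ∅ and v = full, and the path goes
-- through a point z common to both slices.
monotonePath : ∀ {n} (E : Family n) → Extremal E → ∀ {u v} → u ⊑ v → u ∈ E → v ∈ E → MonotonePath E u v
monotonePath {zero} E _ {[]} {[]} _ u∈E _ = record
  { length = 0 ; length≡ = refl ; point = λ _ → [] ; point∈ = λ _ _ → u∈E
  ; above = λ _ _ () ; below = λ _ _ ()
  ; flip = λ _ () ; flip-off = λ _ () ; flip-on = λ _ ()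
  ; flipped⇒ = λ _ _ () ; flipped⇐ = λ _ _ () }
monotonePath {suc n} E ext {u} {v} u⊑v u∈E v∈E with agree-or-opposite u v u⊑v
... | inj₁ (j , u[j]≡v[j]) =
  subst₂ (MonotonePath E) u≡ v≡
    (MonotonePath-insertAt E j b (monotonePath (sliceAt j b E) (Extremal-sliceAt j E ext b) u′⊑v′
      (subst (_∈ E) (sym u≡) u∈E) (subst (_∈ E) (sym v≡) v∈E)))
  where
  b = lookup u j
  u≡ : insertAt (removeAt u j) j b ≡ u
  u≡ = insertAt-removeAt u j
  v≡ : insertAt (removeAt v j) j b ≡ v
  v≡ = trans (cong (insertAt (removeAt v j) j) u[j]≡v[j]) (insertAt-removeAt v j)
  u′⊑v′ : removeAt u j ⊑ removeAt v j
  u′⊑v′ = insertAt-⊑⁻ _ _ j b (subst₂ _⊑_ (sym u≡) (sym v≡) u⊑v)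
monotonePath {suc n} E ext {a ∷ u} {c ∷ v} u⊑v u∈E v∈E | inj₂ opposite
  with refl ← proj₁ (opposite zero) | refl ← proj₂ (opposite zero) =
  Join.path E u⊑z z⊑v (monotonePath (slice false E) (Extremal-sliceAt zero E ext false) u⊑z u∈E z∈E₀)
                      (monotonePath (slice true E) (Extremal-sliceAt zero E ext true) z⊑v z∈E₁ v∈E)
  where
  meet = Extremal-slices-meet E ext u v u∈E v∈E
  z = proj₁ meet
  z∈E₀ = ∧-conicalˡ _ _ (proj₂ meet)
  z∈E₁ = ∧-conicalʳ _ _ (proj₂ meet)
  u⊑z : u ⊑ z
  u⊑z p e with () ← trans (sym e) (proj₁ (opposite (suc p)))
  z⊑v : z ⊑ v
  z⊑v p _ = proj₂ (opposite (suc p))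

-- Read backwards, the first N steps of a monotone path form a half-graph.
MonotonePath⇒halfGraph : ∀ {n} {E : Family n} {u v} (P : MonotonePath E u v) (let open MonotonePath P) →
  ∀ {N} → N ≤ length → Σ (Fin N → ℕ) λ step → Σ (Fin N → Fin n) λ coordinate →
    (∀ i → step i ≤ length) × (∀ i j → lookup (point (step i)) (coordinate j) ≡ true ⇔ i Fin.< j)
MonotonePath⇒halfGraph P {N} N≤l = step , coordinate , step≤l , λ i j → mk⇔ (to i j) (from i j)
  where
  open MonotonePath P
  <l : ∀ (i : Fin N) → toℕ i < length
  <l i = ≤-trans (toℕ<n i) N≤l
  step : Fin N → ℕ
  step i = length ∸ suc (toℕ i)
  step<l : ∀ i → step i < length
  step<l i = ∸-monoʳ-< (s≤s z≤n) (<l i)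
  step≤l : ∀ i → step i ≤ length
  step≤l i = <⇒≤ (step<l i)
  coordinate : Fin N → Fin _
  coordinate j = flip (step j) (step<l j)
  to : ∀ i j → lookup (point (step i)) (coordinate j) ≡ true → i Fin.< j
  to i j e = s<s⁻¹ (∸-cancelʳ-< {o = length} (flipped⇒ (step i) (step j) (step<l j) (step≤l i) e))
  from : ∀ i j → i Fin.< j → lookup (point (step i)) (coordinate j) ≡ true
  from i j i<j = flipped⇐ (step i) (step j) (step<l j) (step≤l i) (∸-monoʳ-< (s≤s i<j) (<l j))

rank : ∀ {n} (E : Family n) v → v ∈ E → Fin (card E)
rank {zero}  E []      e rewrite e = zero
rank {suc n} E (false ∷ v) e = rank (slice false E) v e ↑ˡ card (slice true E)
rank {suc n} E (true ∷ v)  e = card (slice false E) ↑ʳ rank (slice true E) v e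

↑ˡ≢↑ʳ : ∀ {m n} (i : Fin m) (j : Fin n) → i ↑ˡ n ≢ m ↑ʳ j
↑ˡ≢↑ʳ {m} {n} i j eq with () ← trans (sym (splitAt-↑ˡ m i n)) (trans (cong (splitAt m) eq) (splitAt-↑ʳ m n j))

rank-injective : ∀ {n} (E : Family n) v w v∈E w∈E → rank E v v∈E ≡ rank E w w∈E → v ≡ w
rank-injective {zero} E [] [] _ _ _ = refl
rank-injective {suc n} E (false ∷ v) (false ∷ w) v∈E w∈E eq =
  cong (false ∷_) (rank-injective (slice false E) v w v∈E w∈E (↑ˡ-injective _ _ _ eq))
rank-injective {suc n} E (true ∷ v) (true ∷ w) v∈E w∈E eq =
  cong (true ∷_) (rank-injective (slice true E) v w v∈E w∈E (↑ʳ-injective _ _ _ eq))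
rank-injective {suc n} E (false ∷ v) (true ∷ w) _ _ eq = ⊥-elim (↑ˡ≢↑ʳ _ _ eq)
rank-injective {suc n} E (true ∷ v) (false ∷ w) _ _ eq = ⊥-elim (↑ˡ≢↑ʳ _ _ (sym eq))

injection⇒≤card : ∀ {n k} (E : Family n) (g : Fin k → Vec Bool n) → Injective _≡_ _≡_ g →
  (∀ i → g i ∈ E) → k ≤ card E
injection⇒≤card E g g-inj g∈E =
  injective⇒≤ (λ {i} {j} eq → g-inj (rank-injective E (g i) (g j) (g∈E i) (g∈E j) eq))

listed : ∀ {n k} → Vec (Vec Bool n) k → Family n
listed L v = does (any? (≡-dec Bool._≟_ v) L)

listed-sound : ∀ {n k} (L : Vec (Vec Bool n) k) v → v ∈ listed L → ∃ λ i → lookup L i ≡ v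
listed-sound L v e with any? (≡-dec Bool._≟_ v) L
... | yes v∈L = index v∈L , sym (lookup-index v∈L)

lookup∈listed : ∀ {n k} (L : Vec (Vec Bool n) k) i → lookup L i ∈ listed L
lookup∈listed L i = dec-true (any? (≡-dec Bool._≟_ (lookup L i)) L) (∈-lookup i L)

weight : ∀ {n} → Vec Bool n → ℕ
weight []          = 0
weight (true ∷ S)  = suc (weight S)
weight (false ∷ S) = weight S

position : ∀ {n} (S : Vec Bool n) → Fin (weight S) → Fin n
position (true ∷ S)  zero    = zero
position (true ∷ S)  (suc i) = suc (position S i)
position (false ∷ S) i       = suc (position S i)

position-injective : ∀ {n} (S : Vec Bool n) → Injective _≡_ _≡_ (position S)
position-injective (true ∷ S)  {zero}  {zero}  _  = refl
position-injective (true ∷ S)  {suc i} {suc j} eq = cong suc (position-injective S (suc-injective eq))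
position-injective (false ∷ S)                 eq = position-injective S (suc-injective eq)

position∈ : ∀ {n} (S : Vec Bool n) i → lookup S (position S i) ≡ true
position∈ (true ∷ S)  zero    = refl
position∈ (true ∷ S)  (suc i) = position∈ S i
position∈ (false ∷ S) i       = position∈ S i

weight-tabulate-complement : ∀ {n} (f f′ : Fin n → Bool) → (∀ i → f′ i ≡ not (f i)) →
  weight (tabulate f) + weight (tabulate f′) ≡ n
weight-tabulate-complement {zero} f f′ f′≡ = refl
weight-tabulate-complement {suc n} f f′ f′≡ with f zero | f′ zero | f′≡ zero
... | true  | false | _ = cong suc (weight-tabulate-complement (f ∘ suc) (f′ ∘ suc) (f′≡ ∘ suc))
... | false | true  | _ = trans (+-suc _ _) (cong suc (weight-tabulate-complement (f ∘ suc) (f′ ∘ suc) (f′≡ ∘ suc)))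

truncate : ∀ {n} → ℕ → Vec Bool n → Vec Bool n
truncate k       []          = []
truncate zero    (_ ∷ S)     = false ∷ truncate zero S
truncate (suc k) (true ∷ S)  = true ∷ truncate k S
truncate (suc k) (false ∷ S) = false ∷ truncate (suc k) S

weight-truncate : ∀ {n} k (S : Vec Bool n) → k ≤ weight S → weight (truncate k S) ≡ k
weight-truncate zero    []          _         = refl
weight-truncate zero    (_ ∷ S)     _         = weight-truncate zero S z≤n
weight-truncate (suc k) (true ∷ S)  (s≤s k≤w) = cong suc (weight-truncate k S k≤w)
weight-truncate (suc k) (false ∷ S) k≤w       = weight-truncate (suc k) S k≤w

truncate-⊑ : ∀ {n} k (S : Vec Bool n) → truncate k S ⊑ S
truncate-⊑ k       []          ()
truncate-⊑ zero    (_ ∷ S)     = ∷-⊑ (λ ()) (truncate-⊑ zero S)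
truncate-⊑ (suc k) (true ∷ S)  = ∷-⊑ (λ e → e) (truncate-⊑ k S)
truncate-⊑ (suc k) (false ∷ S) = ∷-⊑ (λ e → e) (truncate-⊑ (suc k) S)

Shattered-antitone : ∀ {n} (E : Family n) (S′ S : Vec Bool n) → S′ ⊑ S → S ∈ Shattered E → S′ ∈ Shattered E
Shattered-antitone {zero} E [] [] _ e = e
Shattered-antitone {suc n} E (false ∷ S′) (false ∷ S) S′⊑S e = Shattered-antitone _ S′ S (∷-⊑⁻ S′⊑S) e
Shattered-antitone {suc n} E (true ∷ S′) (true ∷ S) S′⊑S e =
  ∧-true (Shattered-antitone _ S′ S (∷-⊑⁻ S′⊑S) (∧-conicalˡ _ _ e))
         (Shattered-antitone _ S′ S (∷-⊑⁻ S′⊑S) (∧-conicalʳ _ _ e))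
Shattered-antitone {suc n} E (false ∷ S′) (true ∷ S) S′⊑S e =
  Shattered-∪ (slice false E) (slice true E) S′
    (∨-trueˡ _ (Shattered-antitone _ S′ S (∷-⊑⁻ S′⊑S) (∧-conicalˡ _ _ e)))
Shattered-antitone {suc n} E (true ∷ S′) (false ∷ S) S′⊑S e with () ← S′⊑S zero refl

SizeAtMost : ∀ {n} → ℕ → Family n
SizeAtMost d       []          = true
SizeAtMost d       (false ∷ S) = SizeAtMost d S
SizeAtMost zero    (true ∷ S)  = false
SizeAtMost (suc d) (true ∷ S)  = SizeAtMost d S

weight≤⇒SizeAtMost : ∀ {n} d (S : Vec Bool n) → weight S ≤ d → S ∈ SizeAtMost d
weight≤⇒SizeAtMost d       []          _         = refl
weight≤⇒SizeAtMost d       (false ∷ S) w≤d       = weight≤⇒SizeAtMost d S w≤d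
weight≤⇒SizeAtMost (suc d) (true ∷ S)  (s≤s w≤d) = weight≤⇒SizeAtMost d S w≤d

card-empty : ∀ n → card {n} (λ _ → false) ≡ 0
card-empty zero    = refl
card-empty (suc n) = cong₂ _+_ (card-empty n) (card-empty n)

Φ-zero : ∀ d → Φ d 0 ≡ 1
Φ-zero zero    = refl
Φ-zero (suc d) = trans (+-identityʳ (Φ d 0)) (Φ-zero d)

Φ-pascal : ∀ d n → Φ (suc d) (suc n) ≡ Φ (suc d) n + Φ d n
Φ-pascal zero n = begin
  1 + suc n C 1   ≡⟨ cong (1 +_) (nCk+nC[k+1]≡[n+1]C[k+1] n 0) ⟨
  1 + (1 + n C 1) ≡⟨ +-comm 1 (1 + n C 1) ⟩
  (1 + n C 1) + 1 ∎
  where open ≡-Reasoning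
Φ-pascal (suc d) n = begin
  Φ (suc d) (suc n) + suc n C suc (suc d)
    ≡⟨ cong₂ _+_ (Φ-pascal d n) (sym (nCk+nC[k+1]≡[n+1]C[k+1] n (suc d))) ⟩
  (Φ (suc d) n + Φ d n) + (n C suc d + n C suc (suc d))
    ≡⟨ cong ((Φ (suc d) n + Φ d n) +_) (+-comm (n C suc d) (n C suc (suc d))) ⟩
  (Φ (suc d) n + Φ d n) + (n C suc (suc d) + n C suc d)
    ≡⟨ interchange (Φ (suc d) n) (Φ d n) (n C suc (suc d)) (n C suc d) ⟩
  (Φ (suc d) n + n C suc (suc d)) + (Φ d n + n C suc d) ∎
  where open ≡-Reasoning

card-SizeAtMost : ∀ n d → card {n} (SizeAtMost d) ≡ Φ d n
card-SizeAtMost zero    d       = sym (Φ-zero d)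
card-SizeAtMost (suc n) zero    = cong₂ _+_ (card-SizeAtMost n zero) (card-empty n)
card-SizeAtMost (suc n) (suc d) = trans (cong₂ _+_ (card-SizeAtMost n (suc d)) (card-SizeAtMost n d)) (sym (Φ-pascal d n))

tabulate-≗-replicate : ∀ {n} {A : Set} (f : Fin n → A) x → (∀ i → f i ≡ x) → tabulate f ≡ replicate n x
tabulate-≗-replicate {zero}  f x f≗x = refl
tabulate-≗-replicate {suc n} f x f≗x = cong₂ _∷_ (f≗x zero) (tabulate-≗-replicate (f ∘ suc) x (f≗x ∘ suc))

module _ {M : Set} {lx ly : ℕ} (φ : Formula M lx ly) where

  Realized : ∀ {n} → Family n → (Fin n → Vec M ly) → (Vec M lx → Set) → Set
  Realized E h Pr = ∀ v → v ∈ E → ∃ λ a → Pr a × trace φ h a ≡ v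

  -- Pr is strengthened along the recursion to remember the values fixed on the coordinates of S passed so far.
  Shattered⇒Shatters : ∀ {n} (E : Family n) (h : Fin n → Vec M ly) (Pr : Vec M lx → Set) → Realized E h Pr →
    ∀ S → S ∈ Shattered E → (s : Vec Bool (weight S)) → ∃ λ a → Pr a × trace φ (h ∘ position S) a ≡ s
  Shattered⇒Shatters {zero} E h Pr realized [] e [] with realized [] e
  ... | a , pa , _ = a , pa , refl
  Shattered⇒Shatters {suc n} E h Pr realized (false ∷ S) e s =
    Shattered⇒Shatters (slice false E ∪ slice true E) (h ∘ suc) Pr realized-∪ S e s
    where
    realized-∪ : Realized (slice false E ∪ slice true E) (h ∘ suc) Pr
    realized-∪ v e′ with ∨-true⁻ (E (false ∷ v)) (E (true ∷ v)) e′
    ... | inj₁ e₀ = let (a , pa , t) = realized (false ∷ v) e₀ in a , pa , ∷-injectiveʳ t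
    ... | inj₂ e₁ = let (a , pa , t) = realized (true ∷ v) e₁ in a , pa , ∷-injectiveʳ t
  Shattered⇒Shatters {suc n} E h Pr realized (true ∷ S) e (b ∷ s) =
    let (a , (pa , φ[a,h0]≡b) , t) = Shattered⇒Shatters (slice b E) (h ∘ suc) Pr′ realized-b S (slice-b b) s
    in a , pa , cong₂ _∷_ φ[a,h0]≡b t
    where
    slice-b : ∀ c → S ∈ Shattered (slice c E)
    slice-b false = ∧-conicalˡ _ _ e
    slice-b true  = ∧-conicalʳ _ _ e
    Pr′ : Vec M lx → Set
    Pr′ a = Pr a × φ a (h zero) ≡ b
    realized-b : Realized (slice b E) (h ∘ suc) Pr′
    realized-b v e′ = let (a , pa , t) = realized (b ∷ v) e′ in a , (pa , ∷-injectiveˡ t) , ∷-injectiveʳ t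

  module _ (d : ℕ) (maximum : Maximum* φ d) where

    no-shattered-of-size : ∀ {k} → k ≡ suc d → (f : Fin k → Vec M ly) → Injective _≡_ _≡_ f → ¬ Shatters φ f
    no-shattered-of-size refl = proj₂ (proj₁ maximum)

    module Traces {n} (h : Fin n → Vec M ly) (h-inj : Injective _≡_ _≡_ h) where

      counted = proj₂ maximum n h h-inj
      traceList = proj₁ counted

      D : Family n
      D = listed traceList

      D-realized : Realized D h (λ _ → ⊤)
      D-realized v e with listed-sound traceList v e
      ... | i , eq with proj₁ (proj₂ (proj₂ counted)) i
      ... | a , t = a , tt , trans t eq

      trace∈D : ∀ a → trace φ h a ∈ D
      trace∈D a with proj₂ (proj₂ (proj₂ counted)) a
      ... | i , eq = subst (_∈ D) eq (lookup∈listed traceList i)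

      Shattered-D⇒weight≤d : ∀ S → S ∈ Shattered D → weight S ≤ d
      Shattered-D⇒weight≤d S S∈ with weight S ≤? d
      ... | yes w≤d = w≤d
      ... | no  w≰d = ⊥-elim (no-shattered-of-size (weight-truncate (suc d) S (≰⇒> w≰d)) (h ∘ position S′)
                               (position-injective S′ ∘ h-inj) shatters)
        where
        S′ = truncate (suc d) S
        shatters : Shatters φ (h ∘ position S′)
        shatters s =
          let S′∈ = Shattered-antitone D S′ S (truncate-⊑ (suc d) S) S∈
              (a , _ , t) = Shattered⇒Shatters D h _ D-realized S′ S′∈ s
          in a , t

      D-extremal : Extremal D
      D-extremal = begin
        card (Shattered D)
          ≤⟨ card-mono (Shattered D) (SizeAtMost d)
               (λ S S∈ → weight≤⇒SizeAtMost d S (Shattered-D⇒weight≤d S S∈)) ⟩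
        card (SizeAtMost {n} d)
          ≡⟨ card-SizeAtMost n d ⟩
        Φ d n
          ≤⟨ injection⇒≤card D (lookup traceList) (proj₁ (proj₂ counted)) (lookup∈listed traceList) ⟩
        card D ∎
        where open ≤-Reasoning

    separated⇒<stability-bound : ((N , no-half-graph) : Stable φ) → ∀ {n} (h : Fin n → Vec M ly) →
      Injective _≡_ _≡_ h → ∀ a b → (∀ i → φ a (h i) ≡ false) → (∀ i → φ b (h i) ≡ true) → n < N
    separated⇒<stability-bound (N , no-half-graph) {n} h h-inj a b a-misses b-contains with N ≤? n
    ... | no  N≰n = ≰⇒> N≰n
    ... | yes N≤n = ⊥-elim (no-half-graph as bs half-graph)
      where
      open Traces h h-inj
      P = monotonePath D D-extremal (λ p _ → lookup-replicate p true)
            (subst (_∈ D) (tabulate-≗-replicate _ false a-misses) (trace∈D a))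
            (subst (_∈ D) (tabulate-≗-replicate _ true b-contains) (trace∈D b))
      open MonotonePath P using (point; point∈; length≡)
      steps = MonotonePath⇒halfGraph P (subst (N ≤_) (sym (trans length≡ (ascents-∅-full n))) N≤n)
      step = proj₁ steps
      coordinate = proj₁ (proj₂ steps)
      realizer : ∀ i → ∃ λ a → ⊤ × trace φ h a ≡ point (step i)
      realizer i = D-realized (point (step i)) (point∈ (step i) (proj₁ (proj₂ (proj₂ steps)) i))
      as : Fin N → Vec M lx
      as i = proj₁ (realizer i)
      bs : Fin N → Vec M ly
      bs j = h (coordinate j)
      φ[as,bs]≡ : ∀ i j → φ (as i) (bs j) ≡ lookup (point (step i)) (coordinate j)
      φ[as,bs]≡ i j = trans (sym (lookup∘tabulate (λ q → φ (as i) (h q)) (coordinate j)))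
                            (cong (λ t → lookup t (coordinate j)) (proj₂ (proj₂ (realizer i))))
      half-graph : ∀ i j → T (φ (as i) (bs j)) ⇔ (i Fin.< j)
      half-graph i j rewrite φ[as,bs]≡ i j = ⇔.trans T-≡ (proj₂ (proj₂ (proj₂ steps)) i j)

    complementary⇒weight< : ((N , _) : Stable φ) → ∀ {m} (g : Fin m → Vec M ly) → Injective _≡_ _≡_ g →
      ∀ a b → (∀ p → φ b (g p) ≡ not (φ a (g p))) → weight (tabulate (λ p → φ a (g p))) < N
    complementary⇒weight< stable g g-inj a b b≡not-a =
      separated⇒<stability-bound stable (g ∘ position S) (position-injective S ∘ g-inj) b a
        (λ i → trans (b≡not-a (position S i)) (cong not (a-contains i))) a-contains
      where
      S = tabulate (λ p → φ a (g p))
      a-contains : ∀ i → φ a (g (position S i)) ≡ true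
      a-contains i = trans (sym (lookup∘tabulate (λ p → φ a (g p)) (position S i))) (position∈ S i)

lemma2p14 : {M : Set} {lx ly : ℕ} (φ : Formula M lx ly) (d : ℕ) →
    Stable φ → Maximum* φ d →
    ∃ λ N → (a₁ a₂ : Vec M lx) → SymDiffSmallerThan φ a₁ a₂ N
lemma2p14 φ d stable@(N , _) maximum = N + N , λ a₁ a₂ g g-inj g⊆c₁Δc₂ →
  let c₂≡¬c₁ = λ p → T-xor⇒≡not (g⊆c₁Δc₂ p)
      c₁≡¬c₂ = λ p → T-xor⇒≡not (swap (g⊆c₁Δc₂ p))
      c₁∖c₂<N = complementary⇒weight< φ d maximum stable g g-inj a₁ a₂ c₂≡¬c₁
      c₂∖c₁<N = complementary⇒weight< φ d maximum stable g g-inj a₂ a₁ c₁≡¬c₂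
  in <-irrefl (weight-tabulate-complement _ _ c₂≡¬c₁) (+-mono-< c₁∖c₂<N c₂∖c₁<N)
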